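{- Let $G$ be a maximal triangle-free subgraph of $\mathcal D_n$. If $v$ is a vertex of $G$, then so is its conjugate $v^*$.
   Context: Let $e_1,\dots,e_n$ be an orthonormal basis of $\mathbb R^n$. $\mathcal D_n$ is the signed graph with the $n(n-1)$ vertices $e_i\pm e_j$ ($1\le i<j\le n$), distinct vertices $u,v$ being joined by an edge of sign $u\cdot v$ whenever $u\cdot v\ne0$. Subgraphs are induced subgraphs (on subsets of the vertex set). A triangle is a set of three pairwise adjacent vertices. A maximal triangle-free subgraph of $\mathcal D_n$ is a triangle-free induced subgraph not contained in a strictly larger triangle-free induced subgraph of $\mathcal D_n$. For $v=e_i\pm e_j$ ($i<j$) the conjugate vertex is $v^*=e_i\mp e_j$. -}

module Defs where

open import Data.Nat using (ℕ)
open import Data.Fin using (Fin; _<_; _≟_)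
open import Data.Bool using (Bool; true; false; if_then_else_; not)
open import Data.Integer using (ℤ; 0ℤ; 1ℤ; -1ℤ; _+_; _*_)
open import Data.List using (foldr; map; allFin)
open import Data.Product using (Σ-syntax; _×_)
open import Relation.Nullary using (¬_; does)
open import Relation.Binary.PropositionalEquality using (_≡_; _≢_)

-- A vertex e_i + e_j (plus = true) or e_i - e_j (plus = false), with i < j.
record Vertex (n : ℕ) : Set where
  constructor vtx
  field
    i    : Fin n
    j    : Fin n
    i<j  : i < j
    plus : Bool
open Vertex public

vec : ∀ {n} → Vertex n → Fin n → ℤ
vec v k =
  if does (k ≟ i v) then 1ℤ
  else if does (k ≟ j v) then (if plus v then 1ℤ else -1ℤ)
  else 0ℤ

_·_ : ∀ {n} → Vertex n → Vertex n → ℤ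
_·_ {n} u v = foldr _+_ 0ℤ (map (λ k → vec u k * vec v k) (allFin n))

Adjacent : ∀ {n} → Vertex n → Vertex n → Set
Adjacent u v = (u ≢ v) × ((u · v) ≢ 0ℤ)

conj : ∀ {n} → Vertex n → Vertex n
conj (vtx a b p s) = vtx a b p (not s)

-- Induced subgraphs = subsets of the (finite) vertex set, given by
-- their characteristic function.
VSubset : ℕ → Set
VSubset n = Vertex n → Bool

_∈_ : ∀ {n} → Vertex n → VSubset n → Set
v ∈ S = S v ≡ true

_⊆_ : ∀ {n} → VSubset n → VSubset n → Set
S ⊆ T = ∀ v → v ∈ S → v ∈ T

HasTriangle : ∀ {n} → VSubset n → Set
HasTriangle {n} S =
  Σ[ u ∈ Vertex n ] Σ[ v ∈ Vertex n ] Σ[ w ∈ Vertex n ]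
    (u ∈ S × v ∈ S × w ∈ S × Adjacent u v × Adjacent v w × Adjacent u w)

TriangleFree : ∀ {n} → VSubset n → Set
TriangleFree S = ¬ HasTriangle S

MaximalTriangleFree : ∀ {n} → VSubset n → Set
MaximalTriangleFree {n} S =
  TriangleFree S × (∀ (T : VSubset n) → S ⊆ T → TriangleFree T → T ⊆ S)

-- Every neighbour of v* is a neighbour of v, so adding v* to a
-- triangle-free G containing v creates no triangle: v* is never adjacent to
-- v, and in any triangle through v* we may put v in its place.  Maximality
-- then forces v* ∈ G.  The neighbourhood claim is a computation with
-- u·v = u_i ± u_j: if u is orthogonal to v but not to v*, then u_i and u_j
-- are both nonzero, so u = e_i ± e_j, and orthogonality pins down u = v*.
module Submission where

open import Data.Nat using (ℕ; zero; suc)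
open import Defs

open import Data.Fin using (Fin; zero; suc; _<_; _≟_)
import Data.Fin.Properties as Fin
open import Data.Bool using (Bool; true; false; if_then_else_; not; _∨_)
import Data.Bool.Properties as Bool
open import Data.Integer using (ℤ; 0ℤ; 1ℤ; -1ℤ; _+_; _*_)
open import Data.Integer.Properties
  using (+-0-commutativeMonoid; +-identityˡ; +-identityʳ; *-identityʳ; *-zeroʳ; *-comm; i*j≡0⇒i≡0∨j≡0)
open import Algebra.Properties.CommutativeMonoid.Sum +-0-commutativeMonoid
  using (sum; ∑-distrib-+; sum-replicate-zero; sum-cong-≗)
open import Data.List using (foldr; map; allFin; tabulate)
open import Data.List.Properties using (map-tabulate; map-cong)
open import Data.Product using (_×_; _,_; proj₁; proj₂)
open import Data.Sum using (_⊎_; inj₁; inj₂)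
open import Data.Empty using (⊥-elim)
open import Relation.Nullary using (does; yes; no; Dec)
open import Relation.Binary.PropositionalEquality

sign : Bool → ℤ
sign s = if s then 1ℤ else -1ℤ

indicator : ∀ {n} → Fin n → ℤ → Fin n → ℤ
indicator a x k = if does (k ≟ a) then x else 0ℤ

foldr-tabulate≡sum : ∀ {n} (f : Fin n → ℤ) → foldr _+_ 0ℤ (tabulate f) ≡ sum f
foldr-tabulate≡sum {zero}  f = refl
foldr-tabulate≡sum {suc n} f = cong (f zero +_) (foldr-tabulate≡sum (λ k → f (suc k)))

sum-indicator : ∀ {n} (a : Fin n) x → sum (indicator a x) ≡ x
sum-indicator {suc n} zero    x = trans (cong (x +_) (sum-replicate-zero n)) (+-identityʳ x)
sum-indicator {suc n} (suc a) x = trans (+-identityˡ _) (sum-indicator a x)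

vec-i : ∀ {n} (u : Vertex n) → vec u (i u) ≡ 1ℤ
vec-i u with i u ≟ i u
... | yes _  = refl
... | no i≢i = ⊥-elim (i≢i refl)

vec-j : ∀ {n} (u : Vertex n) → vec u (j u) ≡ sign (plus u)
vec-j u with j u ≟ i u
... | yes j≡i = ⊥-elim (Fin.<-irrefl (sym j≡i) (i<j u))
... | no _ with j u ≟ j u
...   | yes _  = refl
...   | no j≢j = ⊥-elim (j≢j refl)

vec-support : ∀ {n} (u : Vertex n) k → vec u k ≢ 0ℤ → k ≡ i u ⊎ k ≡ j u
vec-support u k uₖ≢0 with k ≟ i u
... | yes k≡i = inj₁ k≡i
... | no _ with k ≟ j u
...   | yes k≡j = inj₂ k≡j
...   | no _    = ⊥-elim (uₖ≢0 refl)

vec-*-vec : ∀ {n} (u v : Vertex n) k →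
  vec u k * vec v k ≡ indicator (i v) (vec u (i v)) k + indicator (j v) (sign (plus v) * vec u (j v)) k
vec-*-vec u v k with k ≟ i v
... | yes refl with k ≟ j v
...   | yes k≡j = ⊥-elim (Fin.<-irrefl k≡j (i<j v))
...   | no _    = trans (*-identityʳ (vec u k)) (sym (+-identityʳ (vec u k)))
vec-*-vec u v k | no _ with k ≟ j v
... | yes refl = trans (*-comm (vec u k) (sign (plus v))) (sym (+-identityˡ _))
... | no _     = *-zeroʳ (vec u k)

·-coordinates : ∀ {n} (u v : Vertex n) → u · v ≡ vec u (i v) + sign (plus v) * vec u (j v)
·-coordinates {n} u v = begin
  foldr _+_ 0ℤ (map (λ k → vec u k * vec v k) (allFin n))
    ≡⟨ cong (foldr _+_ 0ℤ) (map-tabulate (λ k → k) (λ k → vec u k * vec v k)) ⟩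
  foldr _+_ 0ℤ (tabulate (λ k → vec u k * vec v k))
    ≡⟨ foldr-tabulate≡sum (λ k → vec u k * vec v k) ⟩
  sum (λ k → vec u k * vec v k)
    ≡⟨ sum-cong-≗ (vec-*-vec u v) ⟩
  sum (λ k → indicator (i v) x k + indicator (j v) y k)
    ≡⟨ ∑-distrib-+ (indicator (i v) x) (indicator (j v) y) ⟩
  sum (indicator (i v) x) + sum (indicator (j v) y)
    ≡⟨ cong₂ _+_ (sum-indicator (i v) x) (sum-indicator (j v) y) ⟩
  x + y ∎
  where
  open ≡-Reasoning
  x = vec u (i v)
  y = sign (plus v) * vec u (j v)

·-comm : ∀ {n} (u v : Vertex n) → u · v ≡ v · u
·-comm {n} u v = cong (foldr _+_ 0ℤ) (map-cong (λ k → *-comm (vec u k) (vec v k)) (allFin n))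

sign*≡0⇒≡0 : ∀ s {y} → sign s * y ≡ 0ℤ → y ≡ 0ℤ
sign*≡0⇒≡0 s eq with i*j≡0⇒i≡0∨j≡0 (sign s) eq
sign*≡0⇒≡0 true  eq | inj₁ ()
sign*≡0⇒≡0 false eq | inj₁ ()
... | inj₂ y≡0 = y≡0

sign-not-cancel : ∀ s → 1ℤ + sign (not s) * sign s ≡ 0ℤ
sign-not-cancel true  = refl
sign-not-cancel false = refl

sign-cancel⇒not : ∀ s t → 1ℤ + sign s * sign t ≡ 0ℤ → t ≡ not s
sign-cancel⇒not true  false _ = refl
sign-cancel⇒not false true  _ = refl
sign-cancel⇒not true  true  ()
sign-cancel⇒not false false ()

one-sign-vanishes⇒nonzero : ∀ s {x y} → x + sign s * y ≡ 0ℤ → x + sign (not s) * y ≢ 0ℤ →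
  x ≢ 0ℤ × y ≢ 0ℤ
one-sign-vanishes⇒nonzero s {x} {y} eq ne = x≢0 , y≢0
  where
  y≢0 : y ≢ 0ℤ
  y≢0 refl = ne (begin
    x + sign (not s) * 0ℤ ≡⟨ cong (x +_) (*-zeroʳ (sign (not s))) ⟩
    x + 0ℤ                ≡⟨ cong (x +_) (*-zeroʳ (sign s)) ⟨
    x + sign s * 0ℤ       ≡⟨ eq ⟩
    0ℤ                    ∎)
    where open ≡-Reasoning

  x≢0 : x ≢ 0ℤ
  x≢0 refl = y≢0 (sign*≡0⇒≡0 s (trans (sym (+-identityˡ _)) eq))

vertex-≡ : ∀ {n} {u v : Vertex n} → i u ≡ i v → j u ≡ j v → plus u ≡ plus v → u ≡ v
vertex-≡ {u = vtx a b p s} {vtx _ _ q _} refl refl refl = cong (λ r → vtx a b r s) (Fin.<-irrelevant p q)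

_≟ᵥ_ : ∀ {n} (u v : Vertex n) → Dec (u ≡ v)
u ≟ᵥ v with i u ≟ i v | j u ≟ j v | plus u Bool.≟ plus v
... | yes i≡ | yes j≡ | yes s≡ = yes (vertex-≡ i≡ j≡ s≡)
... | no i≢  | _      | _      = no (λ u≡v → i≢ (cong i u≡v))
... | yes _  | no j≢  | _      = no (λ u≡v → j≢ (cong j u≡v))
... | yes _  | yes _  | no s≢  = no (λ u≡v → s≢ (cong plus u≡v))

support-pair : ∀ {n} (u : Vertex n) {a b} → a < b → vec u a ≢ 0ℤ → vec u b ≢ 0ℤ →
  a ≡ i u × b ≡ j u
support-pair u {a} {b} a<b ua≢0 ub≢0 with vec-support u a ua≢0 | vec-support u b ub≢0
... | inj₁ a≡i | inj₂ b≡j = a≡i , b≡j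
... | inj₁ a≡i | inj₁ b≡i = ⊥-elim (Fin.<-irrefl (trans a≡i (sym b≡i)) a<b)
... | inj₂ a≡j | inj₂ b≡j = ⊥-elim (Fin.<-irrefl (trans a≡j (sym b≡j)) a<b)
... | inj₂ refl | inj₁ refl = ⊥-elim (Fin.<-asym a<b (i<j u))

·-conj-self : ∀ {n} (v : Vertex n) → v · conj v ≡ 0ℤ
·-conj-self v = begin
  v · conj v
    ≡⟨ ·-coordinates v (conj v) ⟩
  vec v (i v) + sign (not (plus v)) * vec v (j v)
    ≡⟨ cong₂ (λ x y → x + sign (not (plus v)) * y) (vec-i v) (vec-j v) ⟩
  1ℤ + sign (not (plus v)) * sign (plus v)
    ≡⟨ sign-not-cancel (plus v) ⟩
  0ℤ ∎
  where open ≡-Reasoning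

orthogonal⇒≡conj : ∀ {n} (u v : Vertex n) → u · v ≡ 0ℤ → u · conj v ≢ 0ℤ → u ≡ conj v
orthogonal⇒≡conj u v u·v≡0 u·v*≢0 = vertex-≡ (sym iᵥ≡iᵤ) (sym jᵥ≡jᵤ) plusᵤ≡not
  where
  nonzero : vec u (i v) ≢ 0ℤ × vec u (j v) ≢ 0ℤ
  nonzero = one-sign-vanishes⇒nonzero (plus v) (trans (sym (·-coordinates u v)) u·v≡0)
              (λ eq → u·v*≢0 (trans (·-coordinates u (conj v)) eq))

  support : i v ≡ i u × j v ≡ j u
  support = support-pair u (i<j v) (proj₁ nonzero) (proj₂ nonzero)

  iᵥ≡iᵤ = proj₁ support
  jᵥ≡jᵤ = proj₂ support

  plusᵤ≡not : plus u ≡ not (plus v)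
  plusᵤ≡not = sign-cancel⇒not (plus v) (plus u) (begin
    1ℤ + sign (plus v) * sign (plus u)
      ≡⟨ cong₂ (λ x y → x + sign (plus v) * y) (vec-i u) (vec-j u) ⟨
    vec u (i u) + sign (plus v) * vec u (j u)
      ≡⟨ cong₂ (λ x y → vec u x + sign (plus v) * vec u y) iᵥ≡iᵤ jᵥ≡jᵤ ⟨
    vec u (i v) + sign (plus v) * vec u (j v)
      ≡⟨ ·-coordinates u v ⟨
    u · v
      ≡⟨ u·v≡0 ⟩
    0ℤ ∎)
    where open ≡-Reasoning

Adjacent-sym : ∀ {n} {u v : Vertex n} → Adjacent u v → Adjacent v u
Adjacent-sym {u = u} {v} (u≢v , u·v≢0) = (λ v≡u → u≢v (sym v≡u)) , (λ v·u≡0 → u·v≢0 (trans (·-comm u v) v·u≡0))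

_DominatedBy_ : ∀ {n} → Vertex n → Vertex n → Set
w DominatedBy x = ∀ u → Adjacent u w → Adjacent u x

conj-DominatedBy : ∀ {n} (v : Vertex n) → conj v DominatedBy v
conj-DominatedBy v u (u≢v* , u·v*≢0) =
  (λ u≡v → u·v*≢0 (trans (cong (_· conj v) u≡v) (·-conj-self v))) ,
  (λ u·v≡0 → u≢v* (orthogonal⇒≡conj u v u·v≡0 u·v*≢0))

insert : ∀ {n} → Vertex n → VSubset n → VSubset n
insert w S u = S u ∨ does (u ≟ᵥ w)

∈-insert-self : ∀ {n} (w : Vertex n) (S : VSubset n) → w ∈ insert w S
∈-insert-self w S with S w | w ≟ᵥ w
... | true  | _      = refl
... | false | yes _  = refl
... | false | no w≢w = ⊥-elim (w≢w refl)

⊆-insert : ∀ {n} (w : Vertex n) (S : VSubset n) → S ⊆ insert w S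
⊆-insert w S u u∈S rewrite u∈S = refl

∈-insert⁻ : ∀ {n} (w : Vertex n) (S : VSubset n) u → u ∈ insert w S → u ∈ S ⊎ u ≡ w
∈-insert⁻ w S u u∈ with S u | u ≟ᵥ w
... | true  | _       = inj₁ refl
... | false | yes u≡w = inj₂ u≡w

insert-dominated-TriangleFree : ∀ {n} {S : VSubset n} {w x : Vertex n} →
  TriangleFree S → x ∈ S → w DominatedBy x → TriangleFree (insert w S)
insert-dominated-TriangleFree {S = S} {w} {x} free x∈S dom = triangle-free
  where
  domˡ : ∀ {u} → Adjacent w u → Adjacent x u
  domˡ wu = Adjacent-sym (dom _ (Adjacent-sym wu))

  triangle-free : TriangleFree (insert w S)
  triangle-free (a , b , c , a∈ , b∈ , c∈ , ab , bc , ac)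
    with ∈-insert⁻ w S a a∈ | ∈-insert⁻ w S b b∈ | ∈-insert⁻ w S c c∈
  ... | inj₁ a∈S  | inj₁ b∈S  | inj₁ c∈S  = free (a , b , c , a∈S , b∈S , c∈S , ab , bc , ac)
  ... | inj₂ refl | inj₂ refl | _         = proj₁ ab refl
  ... | inj₂ refl | _         | inj₂ refl = proj₁ ac refl
  ... | _         | inj₂ refl | inj₂ refl = proj₁ bc refl
  ... | inj₂ refl | inj₁ b∈S  | inj₁ c∈S  = free (x , b , c , x∈S , b∈S , c∈S , domˡ ab , bc , domˡ ac)
  ... | inj₁ a∈S  | inj₂ refl | inj₁ c∈S  = free (a , x , c , a∈S , x∈S , c∈S , dom a ab , domˡ bc , ac)
  ... | inj₁ a∈S  | inj₁ b∈S  | inj₂ refl = free (a , b , x , a∈S , b∈S , x∈S , ab , dom b bc , dom a ac)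

dominated-∈-MaximalTriangleFree : ∀ {n} {S : VSubset n} {w x : Vertex n} →
  MaximalTriangleFree S → x ∈ S → w DominatedBy x → w ∈ S
dominated-∈-MaximalTriangleFree {S = S} {w} (free , maximal) x∈S dom =
  maximal (insert w S) (⊆-insert w S) (insert-dominated-TriangleFree free x∈S dom) w (∈-insert-self w S)

lemma7p7 : (n : ℕ) (G : VSubset n) → MaximalTriangleFree G →
    (v : Vertex n) → v ∈ G → conj v ∈ G
lemma7p7 n G maximal v v∈G = dominated-∈-MaximalTriangleFree maximal v∈G (conj-DominatedBy v)
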